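{- Let $n \ge 2$, $\phi = \frac{1+\sqrt5}{2}$, $a(k) = \lfloor k\phi \rfloor$, and $D_1 = \{(2^{n-1}-1)a(k)+k : k \ge 1\}$, $D_2 = D_1 \pm 2^{n-2} = \{x - 2^{n-2} : x \in D_1\}\cup\{x+2^{n-2}: x \in D_1\}$. Writing the elements of $D_2$ in increasing order $d_{2,1} < d_{2,2} < \cdots$ and setting $D_2(k) = d_{2,k}$, we have \[ D_2(k) = a(k) + (2^{n-1}-2)k - (2^{n-2}-1) \quad \text{for all } k \ge 1. \] -}

module Defs where

open import Data.Nat as ℕ using (ℕ; suc; _^_; _∸_)
open import Data.Integer as ℤ using (ℤ; +_; _+_; _-_; _*_; _≤_; _<_)
open import Data.Product using (_×_; ∃-syntax)
open import Data.Sum using (_⊎_)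
open import Relation.Binary.PropositionalEquality using (_≡_)

-- FloorMulPhi k m  :⇔  m = ⌊ k φ ⌋  with φ = (1 + √5)/2, i.e.  m ≤ k φ < m + 1.
-- Since reals are unavailable, the two inequalities are written out exactly in ℤ:
--   m ≤ kφ      ⇔  2m - k ≤ k√5      ⇔  2m - k ≤ 0  ∨  (2m - k)² ≤ 5k²
--   kφ < m + 1  ⇔  k√5 < 2m + 2 - k  ⇔  0 < 2m + 2 - k  ∧  5k² < (2m + 2 - k)²
FloorMulPhi : ℕ → ℕ → Set
FloorMulPhi k m =
  ((L ≤ + 0) ⊎ (L * L ≤ + 5 * (K * K)))
  × ((+ 0 < U) × (+ 5 * (K * K) < U * U))
  where
    K L U : ℤ
    K = + k
    L = + 2 * + m - K
    U = + 2 * + m + + 2 - K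

InD1 : ℕ → (ℕ → ℕ) → ℤ → Set
InD1 n a x = ∃[ j ] (1 ℕ.≤ j × x ≡ + ((2 ^ (n ∸ 1) ∸ 1) ℕ.* a j ℕ.+ j))

InD2 : ℕ → (ℕ → ℕ) → ℤ → Set
InD2 n a y = ∃[ x ] (InD1 n a x × ((y ≡ x - + (2 ^ (n ∸ 2))) ⊎ (y ≡ x + + (2 ^ (n ∸ 2)))))

IncreasingEnumeration : (ℤ → Set) → (ℕ → ℤ) → Set
IncreasingEnumeration S d =
  (∀ i j → 1 ℕ.≤ i → i ℕ.< j → d i < d j)
  × (∀ k → 1 ℕ.≤ k → S (d k))
  × (∀ y → S y → ∃[ k ] (1 ℕ.≤ k × d k ≡ y))

module Submission where

-- Write a(k) = ⌊kφ⌋ and P = 2^{n-2}, so that 2^{n-1} = 2P.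
-- 1. Since φ² = φ + 1, "m ≤ kφ" and "kφ < m" are the ℕ-inequalities
--    m² ≤ mk + k² and mk + k² < m² (GoldenInequalities).  From these we get
--    the basic estimates 1 < φ < 2, 3/2 < φ, irrationality of φ, and the
--    reflection Q(m + k, m) = -Q(m, k) of the form Q(m, k) = m² - mk - k².
-- 2. For a(k) this yields (WythoffSequence): a is strictly increasing with
--    gaps 1 or 2, so each k ≥ 1 equals a(j) or a(j) + 1 for some j ≥ 1, and
--    a(a(j)) = a(j) + j - 1,  a(a(j) + 1) = a(j) + j + 1.
-- 3. FloorMulPhi, the √5-free encoding of a(k) = ⌊kφ⌋ in the statement, is
--    converted to the inequalities of step 1 by completing the square.
-- 4. For any P = M + 1 ≥ 1, T(k) = a(k) + 2Mk - M is strictly increasing, and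
--    by step 2 it hits x_j - P at a(j) and x_j + P at a(j) + 1, where
--    x_j = (2P - 1)a(j) + j; so T enumerates D₂ = D₁ ± P.
-- 5. Two increasing enumerations of the same set coincide, so d = T.

open import Defs
open import Data.Nat as ℕ using (ℕ; zero; suc; _^_; _∸_; z≤n; s≤s)
import Data.Nat.Properties as ℕP
open import Data.Product using (_×_; _,_; ∃-syntax; proj₁; proj₂)
open import Data.Sum using (_⊎_; inj₁; inj₂)
open import Data.Empty using (⊥; ⊥-elim)
open import Relation.Binary.Definitions using (tri<; tri≈; tri>)
open import Relation.Binary.PropositionalEquality

module GoldenInequalities where
  open import Data.Nat
  open import Data.Nat.Properties
  open import Data.Nat.Induction using (<-rec)
  open import Data.Nat.Tactic.RingSolver using (solve-∀)
  open ≤-Reasoning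

  -- m ≤ kφ.  Since φ² = φ + 1 this is the φ-free inequality m² ≤ mk + k².
  Below : ℕ → ℕ → Set
  Below k m = m * m ≤ m * k + k * k

  -- kφ < m, i.e. mk + k² < m²; the negation of Below k m.
  Above : ℕ → ℕ → Set
  Above k m = m * k + k * k < m * m

  FloorPhi : ℕ → ℕ → Set
  FloorPhi k m = Below k m × Above k (suc m)

  above⇒> : ∀ {k m} → Above k m → k < m
  above⇒> {k} {m} kφ<m = ≰⇒> λ m≤k → <⇒≱ kφ<m (begin
    m * m         ≤⟨ *-monoʳ-≤ m m≤k ⟩
    m * k         ≤⟨ m≤m+n (m * k) (k * k) ⟩
    m * k + k * k ∎)

  above-upward : ∀ {k m m′} → Above k m → m ≤ m′ → Above k m′
  above-upward {k} {m} kφ<m m≤m′ with m≤n⇒∃[o]m+o≡n m≤m′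
  ... | e , refl = begin-strict
    (m + e) * k + k * k         ≡⟨ expand-left m e k ⟩
    (m * k + k * k) + e * k     <⟨ +-monoˡ-< (e * k) kφ<m ⟩
    m * m + e * k               ≤⟨ +-monoʳ-≤ (m * m) (*-monoʳ-≤ e (<⇒≤ (above⇒> kφ<m))) ⟩
    m * m + e * m               ≤⟨ m≤m+n (m * m + e * m) ((m + e) * e) ⟩
    m * m + e * m + (m + e) * e ≡⟨ expand-right m e ⟩
    (m + e) * (m + e)           ∎
    where
    expand-left : ∀ m e k → (m + e) * k + k * k ≡ (m * k + k * k) + e * k
    expand-left = solve-∀
    expand-right : ∀ m e → m * m + e * m + (m + e) * e ≡ (m + e) * (m + e)
    expand-right = solve-∀

  below-above-< : ∀ {k x y} → Below k x → Above k y → x < y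
  below-above-< x≤kφ kφ<y = ≰⇒> λ y≤x → <⇒≱ (above-upward kφ<y y≤x) x≤kφ

  above-double : ∀ k → Above k (suc (k + k))
  above-double k = begin-strict
    suc (k + k) * k + k * k                          <⟨ s≤s (m≤m+n _ (k * k + 3 * k)) ⟩
    suc ((suc (k + k) * k + k * k) + (k * k + 3 * k)) ≡⟨ square k ⟩
    suc (k + k) * suc (k + k)                        ∎
    where
    square : ∀ k → suc ((suc (k + k) * k + k * k) + (k * k + 3 * k)) ≡ suc (k + k) * suc (k + k)
    square = solve-∀

  below-bound : ∀ {k m} → Below k m → m ≤ k + k
  below-bound {k} m≤kφ = ≮⇒≥ λ 2k<m → <⇒≱ (above-upward (above-double k) 2k<m) m≤kφ

  -- The quadratic form Q(m, k) = m² - mk - k² satisfies Q(m + k, m) = -Q(m, k);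
  -- written without subtraction:
  reflection : ∀ m k → (m + k) * (m + k) + m * m ≡ ((m + k) * m + m * m) + (m * k + k * k)
  reflection = solve-∀

  reflect-below : ∀ {m k} → m * k + k * k ≤ m * m → Below m (m + k)
  reflect-below {m} {k} kφ≤m = +-cancelʳ-≤ (m * m) _ _ (begin
    (m + k) * (m + k) + m * m            ≡⟨ reflection m k ⟩
    ((m + k) * m + m * m) + (m * k + k * k) ≤⟨ +-monoʳ-≤ ((m + k) * m + m * m) kφ≤m ⟩
    ((m + k) * m + m * m) + m * m        ∎)

  reflect-above : ∀ {m k} → m * m < m * k + k * k → Above m (m + k)
  reflect-above {m} {k} m<kφ = +-cancelʳ-< (m * m) _ _ (begin-strict
    ((m + k) * m + m * m) + m * m        <⟨ +-monoʳ-< ((m + k) * m + m * m) m<kφ ⟩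
    ((m + k) * m + m * m) + (m * k + k * k) ≡⟨ reflection m k ⟨
    (m + k) * (m + k) + m * m            ∎)

  small-below : ∀ {k m} → 1 ≤ k → m ≤ k → m * m < m * k + k * k
  small-below {k} {m} 1≤k m≤k = begin-strict
    m * m         ≤⟨ *-monoʳ-≤ m m≤k ⟩
    m * k         <⟨ m<m+n (m * k) (*-mono-≤ 1≤k 1≤k) ⟩
    m * k + k * k ∎

  -- φ is irrational: m² = mk + k² has no solution with k ≥ 1.  By descent: a
  -- solution has k < m, and writing m = k + r, reflection makes (k, r) a
  -- solution with 1 ≤ r < k.
  irrational : ∀ k {m} → 1 ≤ k → m * m ≢ m * k + k * k
  irrational = <-rec _ descent
    where
    descent : ∀ k → (∀ {j} → j < k → ∀ {m} → 1 ≤ j → m * m ≢ m * j + j * j)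
            → ∀ {m} → 1 ≤ k → m * m ≢ m * k + k * k
    descent k smaller {m} 1≤k eq
      with m≤n⇒∃[o]m+o≡n (<⇒≤ (≰⇒> λ m≤k → <-irrefl eq (small-below {k} {m} 1≤k m≤k)))
    ... | r , refl = no-smaller-solution r eq′
      where
      eq′ : k * k ≡ k * r + r * r
      eq′ = +-cancelˡ-≡ ((k + r) * k + k * k) _ _ (begin-equality
        ((k + r) * k + k * k) + k * k       ≡⟨ cong (_+ k * k) eq ⟨
        (k + r) * (k + r) + k * k           ≡⟨ reflection k r ⟩
        ((k + r) * k + k * k) + (k * r + r * r) ∎)
      no-smaller-solution : ∀ s → k * k ≡ k * s + s * s → ⊥
      no-smaller-solution zero    eq₀ = >⇒≢ (*-mono-≤ 1≤k 1≤k) (trans eq₀ (cong (_+ 0) (*-zeroʳ k)))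
      no-smaller-solution (suc s) eq₁ = smaller s<k {k} (s≤s z≤n) eq₁
        where
        s<k : suc s < k
        s<k = ≰⇒> λ k≤s → <-irrefl eq₁ (small-below {suc s} {k} (s≤s z≤n) k≤s)

  below-strict : ∀ {k m} → 1 ≤ k → Below k m → m * m < m * k + k * k
  below-strict {k} {m} 1≤k m≤kφ = ≤∧≢⇒< m≤kφ (irrational k {m} 1≤k)

  -- If m ≤ kφ then m + 1 < (k + 1)φ (as φ > 1):
  -- Q(m + 1, k + 1) = Q(m, k) + m - 3k - 1 < 0, using m ≤ 2k.
  below-succ-strict : ∀ {k m} → Below k m → suc m * suc m < suc m * suc k + suc k * suc k
  below-succ-strict {k} {m} m≤kφ = begin-strict
    suc m * suc m                                     ≡⟨ square m ⟩
    m * m + (m + m + 1)                               ≤⟨ +-monoˡ-≤ (m + m + 1) m≤kφ ⟩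
    (m * k + k * k) + (m + m + 1)                     ≤⟨ +-monoʳ-≤ (m * k + k * k) m+m+1≤ ⟩
    (m * k + k * k) + (m + (k + k) + 1)               <⟨ m<m+n _ (s≤s z≤n) ⟩
    (m * k + k * k) + (m + (k + k) + 1) + suc k       ≡⟨ expand m k ⟩
    suc m * suc k + suc k * suc k                     ∎
    where
    square : ∀ m → suc m * suc m ≡ m * m + (m + m + 1)
    square = solve-∀
    expand : ∀ m k → (m * k + k * k) + (m + (k + k) + 1) + suc k ≡ suc m * suc k + suc k * suc k
    expand = solve-∀
    m+m+1≤ : m + m + 1 ≤ m + (k + k) + 1
    m+m+1≤ = +-monoˡ-≤ 1 (+-monoʳ-≤ m (below-bound m≤kφ))

  -- If kφ < m then 3k < 2m (as φ > 3/2): otherwise 4m² ≤ 6mk ≤ 4mk + 3k², so m ≤ kφ.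
  above-three-halves : ∀ {k m} → Above k m → 3 * k < 2 * m
  above-three-halves {k} {m} kφ<m = ≰⇒> λ 2m≤3k → <⇒≱ kφ<m (*-cancelˡ-≤ 4 (begin
    4 * (m * m)                         ≡⟨ square m ⟩
    (2 * m) * (2 * m)                   ≤⟨ *-monoʳ-≤ (2 * m) 2m≤3k ⟩
    (2 * m) * (3 * k)                   ≡⟨ regroup m k ⟩
    4 * (m * k) + (2 * m) * k           ≤⟨ +-monoʳ-≤ (4 * (m * k)) (*-monoˡ-≤ k 2m≤3k) ⟩
    4 * (m * k) + (3 * k) * k           ≤⟨ m≤m+n _ (k * k) ⟩
    4 * (m * k) + (3 * k) * k + k * k   ≡⟨ collect m k ⟩
    4 * (m * k + k * k)                 ∎))
    where
    square : ∀ m → 4 * (m * m) ≡ (2 * m) * (2 * m)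
    square = solve-∀
    regroup : ∀ m k → (2 * m) * (3 * k) ≡ 4 * (m * k) + (2 * m) * k
    regroup = solve-∀
    collect : ∀ m k → 4 * (m * k) + (3 * k) * k + k * k ≡ 4 * (m * k + k * k)
    collect = solve-∀

  -- If kφ < m then (k + 1)φ < m + 2 (as φ < 2):
  -- Q(m + 2, k + 1) = Q(m, k) + 3m - 4k + 1 > 0, using 4k ≤ 3m.
  above-step : ∀ {k m} → Above k m → Above (suc k) (suc (suc m))
  above-step {k} {m} kφ<m = begin-strict
    suc (suc m) * suc k + suc k * suc k  ≡⟨ expand m k ⟩
    (m * k + k * k) + (m + 4 * k + 3)    <⟨ +-monoˡ-< (m + 4 * k + 3) kφ<m ⟩
    m * m + (m + 4 * k + 3)              ≤⟨ +-monoʳ-≤ (m * m) (+-monoˡ-≤ 3 (+-monoʳ-≤ m 4k≤3m)) ⟩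
    m * m + (m + 3 * m + 3)              <⟨ n<1+n _ ⟩
    suc (m * m + (m + 3 * m + 3))        ≡⟨ square m ⟩
    suc (suc m) * suc (suc m)            ∎
    where
    expand : ∀ m k → suc (suc m) * suc k + suc k * suc k ≡ (m * k + k * k) + (m + 4 * k + 3)
    expand = solve-∀
    square : ∀ m → suc (m * m + (m + 3 * m + 3)) ≡ suc (suc m) * suc (suc m)
    square = solve-∀
    split : ∀ k → 4 * k ≡ 3 * k + k
    split = solve-∀
    4k≤3m : 4 * k ≤ 3 * m
    4k≤3m = begin
      4 * k     ≡⟨ split k ⟩
      3 * k + k ≤⟨ +-mono-≤ (<⇒≤ (above-three-halves {k} {m} kφ<m)) (<⇒≤ (above⇒> {k} {m} kφ<m)) ⟩
      2 * m + m ≡⟨ +-comm (2 * m) m ⟩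
      3 * m     ∎

  above-pred : ∀ {k m} → Above (suc k) (suc m) → Above k m
  above-pred {k} {m} kφ<m = ≰⇒> λ m≤kφ → <-asym kφ<m (below-succ-strict {k} {m} m≤kφ)

module WythoffSequence (a : ℕ → ℕ) (a-floor : ∀ k → GoldenInequalities.FloorPhi k (a k)) where
  open import Data.Nat
  open import Data.Nat.Properties
  open GoldenInequalities

  floor-≥ : ∀ {k x} → Below k x → x ≤ a k
  floor-≥ {k} x≤kφ = s≤s⁻¹ (below-above-< x≤kφ (proj₂ (a-floor k)))

  floor-≤ : ∀ {k y} → Above k (suc y) → a k ≤ y
  floor-≤ {k} kφ<y+1 = s≤s⁻¹ (below-above-< (proj₁ (a-floor k)) kφ<y+1)

  floor-unique : ∀ {k m} → FloorPhi k m → a k ≡ m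
  floor-unique (m≤kφ , kφ<m+1) = ≤-antisym (floor-≤ kφ<m+1) (floor-≥ m≤kφ)

  a-one : a 1 ≡ 1
  a-one = floor-unique (s≤s z≤n , ≤-refl)

  a-step-≥ : ∀ k → suc (a k) ≤ a (suc k)
  a-step-≥ k = floor-≥ (<⇒≤ (below-succ-strict {k} {a k} (proj₁ (a-floor k))))

  a-step-≤ : ∀ k → a (suc k) ≤ suc (suc (a k))
  a-step-≤ k = floor-≤ (above-step (proj₂ (a-floor k)))

  a-increasing : ∀ {i j} → i < j → a i < a j
  a-increasing {i} {suc j} i<1+j with m<1+n⇒m<n∨m≡n i<1+j
  ... | inj₁ i<j  = <-≤-trans (a-increasing i<j) (<⇒≤ (a-step-≥ j))
  ... | inj₂ refl = a-step-≥ j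

  a-positive : ∀ {j} → 1 ≤ j → 1 ≤ a j
  a-positive 1≤j = ≤-<-trans z≤n (a-increasing 1≤j)

  -- Since the gaps are 1 or 2, every k ≥ 1 is a value a(j) or a value plus one.
  a-or-succ : ∀ k → 1 ≤ k → ∃[ j ] (1 ≤ j × (k ≡ a j ⊎ k ≡ suc (a j)))
  a-or-succ (suc zero) _ = 1 , ≤-refl , inj₁ (sym a-one)
  a-or-succ (suc (suc k)) _ with a-or-succ (suc k) (s≤s z≤n)
  ... | j , 1≤j , inj₁ k≡aj = j , 1≤j , inj₂ (cong suc k≡aj)
  ... | j , 1≤j , inj₂ k≡1+aj with m≤n⇒m<n∨m≡n (a-step-≥ j)
  ...   | inj₂ gap₁ = suc j , s≤s z≤n , inj₂ (cong suc (trans k≡1+aj gap₁))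
  ...   | inj₁ gap₂ = suc j , s≤s z≤n , inj₁ (trans (cong suc k≡1+aj) (≤-antisym gap₂ (a-step-≤ j)))

  -- a(a(j)) = a(j) + j - 1, for j = i + 1 ≥ 1.  With A = a(j): iφ < A and
  -- A < jφ (strictly, by irrationality), which reflect to A + i ≤ Aφ < A + j.
  a∘a : ∀ i → a (a (suc i)) ≡ a (suc i) + i
  a∘a i = floor-unique
    ( reflect-below {A} {i} (<⇒≤ (above-pred {i} {A} (proj₂ (a-floor (suc i)))))
    , subst (Above A) (+-suc A i) (reflect-above {A} {suc i} (below-strict {suc i} {A} (s≤s z≤n) (proj₁ (a-floor (suc i))))) )
    where
    A : ℕ
    A = a (suc i)

  -- a(a(j) + 1) = a(j) + j + 1.  With B = a(j) + 1: jφ < B and B < (j + 1)φ,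
  -- which reflect to B + j ≤ Bφ < B + j + 1.
  a∘suc∘a : ∀ j → a (suc (a j)) ≡ suc (a j) + j
  a∘suc∘a j = floor-unique
    ( reflect-below {B} {j} (<⇒≤ (proj₂ (a-floor j)))
    , subst (Above B) (+-suc B j) (reflect-above {B} {suc j} (below-succ-strict {j} {a j} (proj₁ (a-floor j)))) )
    where
    B : ℕ
    B = suc (a j)

open import Data.Integer as ℤ using (ℤ; +_; _+_; _-_; _*_; -_; +<+)
import Data.Integer.Properties as ℤP
import Data.Integer.Tactic.RingSolver as ℤSolver
import Data.Nat.Tactic.RingSolver as ℕSolver
open GoldenInequalities using (Below; Above; FloorPhi)

-- Completing the square: (2x - y)² + 4(xy + y²) = 5y² + 4x², solved for 4x².
-- This identity turns the √5-encoding of ⌊kφ⌋ in FloorMulPhi into Below/Above.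
square-completion : ∀ x y → + 4 * (x * x)
  ≡ ((+ 2 * x - y) * (+ 2 * x - y) + + 4 * (x * y + y * y)) - + 5 * (y * y)
square-completion = ℤSolver.solve-∀

square-completion-succ : ∀ x y → + 4 * ((+ 1 + x) * (+ 1 + x))
  ≡ ((+ 2 * x + + 2 - y) * (+ 2 * x + + 2 - y) + + 4 * ((+ 1 + x) * y + y * y)) - + 5 * (y * y)
square-completion-succ = ℤSolver.solve-∀

add-sub : ∀ u v → (u + v) - u ≡ v
add-sub = ℤSolver.solve-∀

cast-square : ∀ m → + m * + m ≡ + (m ℕ.* m)
cast-square m = sym (ℤP.pos-* m m)

cast-form : ∀ m k → + m * + k + + k * + k ≡ + (m ℕ.* k ℕ.+ k ℕ.* k)
cast-form m k = sym (cong₂ _+_ (ℤP.pos-* m k) (ℤP.pos-* k k))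

below-from-ℤ : ∀ k m → + 4 * (+ m * + m) ℤ.≤ + 4 * (+ m * + k + + k * + k) → Below k m
below-from-ℤ k m h = ℤP.drop‿+≤+ (subst₂ ℤ._≤_ (cast-square m) (cast-form m k) (ℤP.*-cancelˡ-≤-pos _ _ (+ 4) h))

above-from-ℤ : ∀ k m → + 4 * (+ m * + k + + k * + k) ℤ.< + 4 * (+ m * + m) → Above k m
above-from-ℤ k m h = ℤP.drop‿+<+ (subst₂ ℤ._<_ (cast-form m k) (cast-square m) (ℤP.*-cancelˡ-<-nonNeg (+ 4) h))

lower-bound : ∀ k m → (+ 2 * + m - + k ℤ.≤ + 0) ⊎ ((+ 2 * + m - + k) * (+ 2 * + m - + k) ℤ.≤ + 5 * (+ k * + k))
  → Below k m
lower-bound k m (inj₁ 2m-k≤0) = ℕP.≤-trans (ℕP.*-monoʳ-≤ m m≤k) (ℕP.m≤m+n (m ℕ.* k) (k ℕ.* k))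
  where
  open ℤP.≤-Reasoning
  shift : ∀ u v → u ≡ (u - v) + v
  shift = ℤSolver.solve-∀
  2m≤k : + (2 ℕ.* m) ℤ.≤ + k
  2m≤k = begin
    + (2 ℕ.* m)          ≡⟨ ℤP.pos-* 2 m ⟩
    + 2 * + m            ≡⟨ shift (+ 2 * + m) (+ k) ⟩
    (+ 2 * + m - + k) + + k ≤⟨ ℤP.+-monoˡ-≤ (+ k) 2m-k≤0 ⟩
    + 0 + + k            ≡⟨ ℤP.+-identityˡ (+ k) ⟩
    + k                  ∎
  m≤k : m ℕ.≤ k
  m≤k = ℕP.≤-trans (ℕP.m≤m+n m (m ℕ.+ 0)) (ℤP.drop‿+≤+ 2m≤k)
lower-bound k m (inj₂ L²≤5k²) = below-from-ℤ k m (begin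
  + 4 * (+ m * + m)                  ≡⟨ square-completion (+ m) (+ k) ⟩
  (L * L + 4Q) - + 5 * (+ k * + k)   ≤⟨ ℤP.+-monoˡ-≤ (- (+ 5 * (+ k * + k))) (ℤP.+-monoˡ-≤ 4Q L²≤5k²) ⟩
  (+ 5 * (+ k * + k) + 4Q) - + 5 * (+ k * + k) ≡⟨ add-sub (+ 5 * (+ k * + k)) 4Q ⟩
  4Q                                 ∎)
  where
  open ℤP.≤-Reasoning
  L 4Q : ℤ
  L = + 2 * + m - + k
  4Q = + 4 * (+ m * + k + + k * + k)

upper-bound : ∀ k m → + 5 * (+ k * + k) ℤ.< (+ 2 * + m + + 2 - + k) * (+ 2 * + m + + 2 - + k)
  → Above k (suc m)
upper-bound k m 5k²<U² = above-from-ℤ k (suc m) (begin-strict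
  4Q                                 ≡⟨ add-sub (+ 5 * (+ k * + k)) 4Q ⟨
  (+ 5 * (+ k * + k) + 4Q) - + 5 * (+ k * + k) <⟨ ℤP.+-monoˡ-< (- (+ 5 * (+ k * + k))) (ℤP.+-monoˡ-< 4Q 5k²<U²) ⟩
  (U * U + 4Q) - + 5 * (+ k * + k)   ≡⟨ square-completion-succ (+ m) (+ k) ⟨
  + 4 * (+ suc m * + suc m)          ∎)
  where
  open ℤP.≤-Reasoning
  U 4Q : ℤ
  U = + 2 * + m + + 2 - + k
  4Q = + 4 * (+ suc m * + k + + k * + k)

floor-phi : ∀ k m → FloorMulPhi k m → FloorPhi k m
floor-phi k m (lower , _ , upper) = lower-bound k m lower , upper-bound k m upper

StrictlyIncreasing : (ℕ → ℤ) → Set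
StrictlyIncreasing d = ∀ i j → 1 ℕ.≤ i → i ℕ.< j → d i ℤ.< d j

increasing-reflects-< : ∀ {e} → StrictlyIncreasing e → ∀ {i j} → 1 ℕ.≤ j → e i ℤ.< e j → i ℕ.< j
increasing-reflects-< e-inc {i} {j} 1≤j ei<ej with ℕP.<-cmp i j
... | tri< i<j _ _  = i<j
... | tri≈ _ refl _ = ⊥-elim (ℤP.<-irrefl refl ei<ej)
... | tri> _ _ j<i  = ⊥-elim (ℤP.<-asym ei<ej (e-inc j i 1≤j j<i))

-- If every term of an increasing d occurs in an increasing e, then the k-th
-- term of d occurs in e at a position ≥ k (the k - 1 smaller terms of d
-- occupy distinct earlier positions).
position-lower-bound : ∀ {d e} → StrictlyIncreasing d → StrictlyIncreasing e
  → (∀ k → 1 ℕ.≤ k → ∃[ m ] (1 ℕ.≤ m × e m ≡ d k))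
  → ∀ k m → 1 ℕ.≤ k → 1 ℕ.≤ m → e m ≡ d k → k ℕ.≤ m
position-lower-bound d-inc e-inc d⊆e (suc zero) _ _ 1≤m _ = 1≤m
position-lower-bound {d} {e} d-inc e-inc d⊆e (suc (suc k)) m _ 1≤m em≡dk =
  ℕP.≤-<-trans (position-lower-bound {d} {e} d-inc e-inc d⊆e (suc k) m′ (s≤s z≤n) 1≤m′ em′≡dk′) m′<m
  where
  m′ : ℕ
  m′ = proj₁ (d⊆e (suc k) (s≤s z≤n))
  1≤m′ : 1 ℕ.≤ m′
  1≤m′ = proj₁ (proj₂ (d⊆e (suc k) (s≤s z≤n)))
  em′≡dk′ : e m′ ≡ d (suc k)
  em′≡dk′ = proj₂ (proj₂ (d⊆e (suc k) (s≤s z≤n)))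
  m′<m : m′ ℕ.< m
  m′<m = increasing-reflects-< e-inc 1≤m
    (subst₂ ℤ._<_ (sym em′≡dk′) (sym em≡dk) (d-inc (suc k) (suc (suc k)) (s≤s z≤n) ℕP.≤-refl))

enumeration-unique : ∀ {S d e} → IncreasingEnumeration S d → IncreasingEnumeration S e
  → ∀ k → 1 ℕ.≤ k → d k ≡ e k
enumeration-unique {d = d} {e = e} (d-inc , d∈S , S⊆d) (e-inc , e∈S , S⊆e) k 1≤k
  with S⊆e (d k) (d∈S k 1≤k)
... | m , 1≤m , em≡dk = trans (sym em≡dk) (cong e (ℕP.≤-antisym m≤k k≤m))
  where
  k≤m : k ℕ.≤ m
  k≤m = position-lower-bound d-inc e-inc (λ j 1≤j → S⊆e (d j) (d∈S j 1≤j)) k m 1≤k 1≤m em≡dk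
  m≤k : m ℕ.≤ k
  m≤k = position-lower-bound e-inc d-inc (λ j 1≤j → S⊆d (e j) (e∈S j 1≤j)) m k 1≤m 1≤k (sym em≡dk)

-- D₁ and D₂ of the theorem with the shift 2^{n-2} replaced by an arbitrary P:
-- D₁ = {(2P - 1) a(j) + j : j ≥ 1} and D₂ = D₁ ± P.
ShiftedD1 : ℕ → (ℕ → ℕ) → ℤ → Set
ShiftedD1 P a x = ∃[ j ] (1 ℕ.≤ j × x ≡ + ((2 ℕ.* P ∸ 1) ℕ.* a j ℕ.+ j))

ShiftedD2 : ℕ → (ℕ → ℕ) → ℤ → Set
ShiftedD2 P a y = ∃[ x ] (ShiftedD1 P a x × ((y ≡ x - + P) ⊎ (y ≡ x + + P)))

difference-cong : ∀ N M N′ M′ → N ℕ.+ M′ ≡ N′ ℕ.+ M → + N - + M ≡ + N′ - + M′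
difference-cong N M N′ M′ eq = begin
  + N - + M                     ≡⟨ extend (+ N) (+ M) (+ M′) ⟩
  (+ N + + M′) - (+ M + + M′)   ≡⟨ cong (λ z → + z - (+ M + + M′)) eq ⟩
  (+ N′ + + M) - (+ M + + M′)   ≡⟨ cancel (+ N′) (+ M) (+ M′) ⟩
  + N′ - + M′                   ∎
  where
  open ≡-Reasoning
  extend : ∀ u v w → u - v ≡ (u + w) - (v + w)
  extend = ℤSolver.solve-∀
  cancel : ∀ u v w → (u + v) - (v + w) ≡ u - w
  cancel = ℤSolver.solve-∀

-- For P = M + 1 the sequence T(k) = a(k) + 2Mk - M enumerates D₂: it takes
-- the value x_j - P at k = a(j) and x_j + P at k = a(j) + 1, where x_j is the
-- j-th element of D₁, and these k cover all k ≥ 1.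
module ShiftedEnumeration (M : ℕ) (a : ℕ → ℕ) (a-floor : ∀ k → FloorPhi k (a k)) where
  open WythoffSequence a a-floor
  open ≡-Reasoning

  P : ℕ
  P = suc M

  T : ℕ → ℤ
  T k = + (a k ℕ.+ 2 ℕ.* M ℕ.* k) - + M

  x : ℕ → ℤ
  x j = + ((2 ℕ.* P ∸ 1) ℕ.* a j ℕ.+ j)

  odd-coefficient : 2 ℕ.* P ∸ 1 ≡ suc (2 ℕ.* M)
  odd-coefficient = cong (_∸ 1) (ℕP.*-suc 2 M)

  even-coefficient : 2 ℕ.* P ∸ 2 ≡ 2 ℕ.* M
  even-coefficient = cong (_∸ 2) (ℕP.*-suc 2 M)

  T-at-a : ∀ i → T (a (suc i)) ≡ x (suc i) - + P
  T-at-a i = difference-cong (a A ℕ.+ 2 ℕ.* M ℕ.* A) M ((2 ℕ.* P ∸ 1) ℕ.* A ℕ.+ suc i) P (begin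
    a A ℕ.+ 2 ℕ.* M ℕ.* A ℕ.+ P           ≡⟨ cong (λ z → z ℕ.+ 2 ℕ.* M ℕ.* A ℕ.+ P) (a∘a i) ⟩
    A ℕ.+ i ℕ.+ 2 ℕ.* M ℕ.* A ℕ.+ P       ≡⟨ rearrange A i M ⟩
    suc (2 ℕ.* M) ℕ.* A ℕ.+ suc i ℕ.+ M   ≡⟨ cong (λ c → c ℕ.* A ℕ.+ suc i ℕ.+ M) odd-coefficient ⟨
    (2 ℕ.* P ∸ 1) ℕ.* A ℕ.+ suc i ℕ.+ M   ∎)
    where
    A : ℕ
    A = a (suc i)
    rearrange : ∀ A i M → A ℕ.+ i ℕ.+ 2 ℕ.* M ℕ.* A ℕ.+ suc M ≡ suc (2 ℕ.* M) ℕ.* A ℕ.+ suc i ℕ.+ M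
    rearrange = ℕSolver.solve-∀

  T-after-a : ∀ j → T (suc (a j)) ≡ x j + + P
  T-after-a j = trans (difference-cong (a (suc A) ℕ.+ 2 ℕ.* M ℕ.* suc A) M ((2 ℕ.* P ∸ 1) ℕ.* A ℕ.+ j ℕ.+ P) 0 (begin
    a (suc A) ℕ.+ 2 ℕ.* M ℕ.* suc A ℕ.+ 0       ≡⟨ cong (λ z → z ℕ.+ 2 ℕ.* M ℕ.* suc A ℕ.+ 0) (a∘suc∘a j) ⟩
    suc A ℕ.+ j ℕ.+ 2 ℕ.* M ℕ.* suc A ℕ.+ 0     ≡⟨ rearrange A j M ⟩
    suc (2 ℕ.* M) ℕ.* A ℕ.+ j ℕ.+ P ℕ.+ M        ≡⟨ cong (λ c → c ℕ.* A ℕ.+ j ℕ.+ P ℕ.+ M) odd-coefficient ⟨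
    (2 ℕ.* P ∸ 1) ℕ.* A ℕ.+ j ℕ.+ P ℕ.+ M        ∎)) (ℤP.+-identityʳ (x j + + P))
    where
    A : ℕ
    A = a j
    rearrange : ∀ A j M → suc A ℕ.+ j ℕ.+ 2 ℕ.* M ℕ.* suc A ℕ.+ 0 ≡ suc (2 ℕ.* M) ℕ.* A ℕ.+ j ℕ.+ suc M ℕ.+ M
    rearrange = ℕSolver.solve-∀

  T-increasing : StrictlyIncreasing T
  T-increasing i j _ i<j = ℤP.+-monoˡ-< (- + M)
    (+<+ (ℕP.+-mono-<-≤ (a-increasing i<j) (ℕP.*-monoʳ-≤ (2 ℕ.* M) (ℕP.<⇒≤ i<j))))

  T-in-D2 : ∀ k → 1 ℕ.≤ k → ShiftedD2 P a (T k)
  T-in-D2 k 1≤k with a-or-succ k 1≤k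
  ... | zero  , ()  , _
  ... | suc i , 1≤j , inj₁ refl = x (suc i) , (suc i , 1≤j , refl) , inj₁ (T-at-a i)
  ... | j     , 1≤j , inj₂ refl = x j , (j , 1≤j , refl) , inj₂ (T-after-a j)

  D2-in-T : ∀ y → ShiftedD2 P a y → ∃[ k ] (1 ℕ.≤ k × T k ≡ y)
  D2-in-T _ (_ , (zero  , ()  , _)    , _)
  D2-in-T _ (_ , (suc i , 1≤j , refl) , inj₁ refl) = a (suc i) , a-positive 1≤j , T-at-a i
  D2-in-T _ (_ , (j     , 1≤j , refl) , inj₂ refl) = suc (a j) , s≤s z≤n , T-after-a j

  T-enumerates : IncreasingEnumeration (ShiftedD2 P a) T
  T-enumerates = T-increasing , T-in-D2 , D2-in-T

  T-closed-form : ∀ k → + a k + + (2 ℕ.* P ∸ 2) * + k - + (P ∸ 1) ≡ T k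
  T-closed-form k = begin
    + a k + + (2 ℕ.* P ∸ 2) * + k - + M   ≡⟨ cong (λ c → + a k + + c * + k - + M) even-coefficient ⟩
    + a k + + (2 ℕ.* M) * + k - + M       ≡⟨ cong (λ z → + a k + z - + M) (ℤP.pos-* (2 ℕ.* M) k) ⟨
    T k                                   ∎

shifted-enumeration : ∀ P → 1 ℕ.≤ P → (a : ℕ → ℕ) → (∀ k → FloorMulPhi k (a k))
  → (d : ℕ → ℤ) → IncreasingEnumeration (ShiftedD2 P a) d
  → ∀ k → 1 ℕ.≤ k → d k ≡ + a k + + (2 ℕ.* P ∸ 2) * + k - + (P ∸ 1)
shifted-enumeration (suc M) _ a a-floor d d-enumerates k 1≤k =
  trans (enumeration-unique d-enumerates T-enumerates k 1≤k) (sym (T-closed-form k))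
  where
  open ShiftedEnumeration M a (λ j → floor-phi j (a j) (a-floor j))

-- Theorem 4.2: with P = 2^{n-2} we have 2^{n-1} = 2P, so D₂ is ShiftedD2 P a.
theorem4p2 : (n : ℕ) → 2 ℕ.≤ n → (a : ℕ → ℕ) → (∀ k → FloorMulPhi k (a k))
    → (d : ℕ → ℤ) → IncreasingEnumeration (InD2 n a) d
    → ∀ k → 1 ℕ.≤ k
    → d k ≡ + a k + + (2 ^ (n ∸ 1) ∸ 2) * + k - + (2 ^ (n ∸ 2) ∸ 1)
theorem4p2 (suc zero) (s≤s ())
theorem4p2 (suc (suc n)) _ = shifted-enumeration (2 ^ n) (ℕP.m^n>0 2 n)
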